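{- Let $\mathscr{C}$ be a pyramidal set system on a finite set $V$. Then $\mathscr{C}$ satisfies (P2): for all $A,B,C,D\in\mathscr{C}$ with $A\between D$, $B\between D$ and $C\between D$, we have $A\subseteq D\cup B\cup C$, or $B\subseteq D\cup A\cup C$, or $C\subseteq D\cup A\cup B$.
   Context: A set system (clustering system) $\mathscr{C}$ of non-empty subsets of $V$ is pyramidal if it is closed under non-empty intersections (if $A,B\in\mathscr{C}$ and $A\cap B\neq\emptyset$ then $A\cap B\in\mathscr{C}$) and there is a total order $<$ on $V$ such that every $C\in\mathscr{C}$ is an interval w.r.t. $<$ (if $x,y\in C$ and $x<u<y$ then $u\in C$). Sets $A,B$ overlap, $A\between B$, if $A\cap B$, $A\setminus B$, $B\setminus A$ are all non-empty. -}

module Defs where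

open import Data.Nat using (ℕ)
open import Data.Fin using (Fin)
open import Data.Fin.Subset using (Subset; _∈_; _⊆_; _∩_; _─_; Nonempty)
open import Data.Product using (_×_; Σ)
open import Relation.Binary.Core using (Rel)
open import Relation.Binary.Structures using (IsStrictTotalOrder)
open import Relation.Binary.PropositionalEquality using (_≡_)
open import Level using (0ℓ; suc)

SetSystem : ℕ → Set₁
SetSystem n = Subset n → Set

IsClusteringSystem : ∀ {n} → SetSystem n → Set
IsClusteringSystem {n} 𝒞 = ∀ (A : Subset n) → 𝒞 A → Nonempty A

ClosedUnderNonemptyIntersections : ∀ {n} → SetSystem n → Set
ClosedUnderNonemptyIntersections {n} 𝒞 =
  ∀ (A B : Subset n) → 𝒞 A → 𝒞 B → Nonempty (A ∩ B) → 𝒞 (A ∩ B)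

IsInterval : ∀ {n} → Rel (Fin n) 0ℓ → Subset n → Set
IsInterval {n} _<_ C = ∀ (x y u : Fin n) → x ∈ C → y ∈ C → x < u → u < y → u ∈ C

IsPyramidal : ∀ {n} → SetSystem n → Set₁
IsPyramidal {n} 𝒞 =
  ClosedUnderNonemptyIntersections 𝒞 ×
  Σ (Rel (Fin n) 0ℓ) (λ _<_ →
    IsStrictTotalOrder _≡_ _<_ × (∀ (C : Subset n) → 𝒞 C → IsInterval _<_ C))

_≬_ : ∀ {n} → Subset n → Subset n → Set
A ≬ B = Nonempty (A ∩ B) × Nonempty (A ─ B) × Nonempty (B ─ A)

-- An interval X overlapping the interval D
-- sticks out of D on one side, and since X also misses a point of D, all of
-- X ∖ D lies beyond D on that side. By pigeonhole two of A, B, C stick out on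
-- the same side, say the left, and such X, Y are nested modulo D: points
-- a ∈ X ∖ (D ∪ Y) and b ∈ Y ∖ (D ∪ X) cannot both exist, since whichever of
-- them is nearer to D lies between the other and D, hence in the other's set.
module Submission where

open import Defs
open import Data.Nat using (ℕ)
open import Data.Fin using (Fin)
open import Data.Fin.Properties using (any?)
open import Data.Fin.Subset using (Subset; _∈_; _∉_; _⊆_; _∪_; _∩_; _─_; Nonempty; inside; outside)
open import Data.Fin.Subset.Properties
  using (_∈?_; x∈p∪q⁺; x∈p∪q⁻; p∩q⊆p; p∩q⊆q; x∈p∧x∉q⇒x∈p─q; p─q⊆p; p⊆p∪q; q⊆p∪q)
open import Data.Vec.Base using (_∷_; here; there)
open import Data.Sum using (_⊎_; inj₁; inj₂)
import Data.Sum as Sum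
open import Data.Empty using (⊥)
open import Data.Product using (_×_; _,_; ∃)
open import Function using (flip; _∘_)
open import Level using (0ℓ)
open import Relation.Binary.Core using (Rel)
open import Relation.Binary.Definitions using (Tri; tri<; tri≈; tri>)
open import Relation.Binary.Structures using (IsStrictTotalOrder)
open import Relation.Binary.PropositionalEquality using (_≡_; refl)
import Relation.Binary.Construct.Flip.EqAndOrd as Flip
open import Relation.Nullary using (yes; no; ¬?; contradiction)
open import Relation.Nullary.Decidable using (_×-dec_; decidable-stable)

private
  variable
    n : ℕ
    x : Fin n
    p q X Y Z D : Subset n

x∈p─q⇒x∉q : x ∈ p ─ q → x ∉ q
x∈p─q⇒x∉q {p = inside ∷ _} {q = outside ∷ _} here ()
x∈p─q⇒x∉q {p = _ ∷ _}      {q = _ ∷ _}       (there x∈p─q) (there x∈q) =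
  x∈p─q⇒x∉q x∈p─q x∈q

x∉p∪q⇒x∉p : x ∉ p ∪ q → x ∉ p
x∉p∪q⇒x∉p x∉p∪q = x∉p∪q ∘ x∈p∪q⁺ ∘ inj₁

x∉p∪q⇒x∉q : x ∉ p ∪ q → x ∉ q
x∉p∪q⇒x∉q x∉p∪q = x∉p∪q ∘ x∈p∪q⁺ ∘ inj₂

⊆-or-∉ : (X S : Subset n) → X ⊆ S ⊎ ∃ λ x → x ∈ X × x ∉ S
⊆-or-∉ X S with any? (λ x → x ∈? X ×-dec ¬? (x ∈? S))
... | yes (x , x∈X , x∉S) = inj₂ (x , x∈X , x∉S)
... | no ∄                = inj₁ λ {x} x∈X →
  decidable-stable (x ∈? S) (λ x∉S → ∄ (x , x∈X , x∉S))

⊆-∪-weakenˡ : X ⊆ D ∪ Y → X ⊆ D ∪ Y ∪ Z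
⊆-∪-weakenˡ {D = D} {Y = Y} {Z = Z} X⊆D∪Y x∈X with x∈p∪q⁻ D Y (X⊆D∪Y x∈X)
... | inj₁ x∈D = x∈p∪q⁺ (inj₁ x∈D)
... | inj₂ x∈Y = x∈p∪q⁺ (inj₂ (p⊆p∪q Z x∈Y))

⊆-∪-weakenʳ : X ⊆ D ∪ Z → X ⊆ D ∪ Y ∪ Z
⊆-∪-weakenʳ {D = D} {Z = Z} {Y = Y} X⊆D∪Z x∈X with x∈p∪q⁻ D Z (X⊆D∪Z x∈X)
... | inj₁ x∈D = x∈p∪q⁺ (inj₁ x∈D)
... | inj₂ x∈Z = x∈p∪q⁺ (inj₂ (q⊆p∪q Y Z x∈Z))

two-on-same-side : ∀ {P₁ P₂ P₃ Q₁ Q₂ Q₃ : Set} → P₁ ⊎ Q₁ → P₂ ⊎ Q₂ → P₃ ⊎ Q₃ →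
  ((P₁ × P₂) ⊎ (Q₁ × Q₂)) ⊎ ((P₁ × P₃) ⊎ (Q₁ × Q₃)) ⊎ ((P₂ × P₃) ⊎ (Q₂ × Q₃))
two-on-same-side (inj₁ p₁) (inj₁ p₂) _         = inj₁ (inj₁ (p₁ , p₂))
two-on-same-side (inj₂ q₁) (inj₂ q₂) _         = inj₁ (inj₂ (q₁ , q₂))
two-on-same-side (inj₁ p₁) (inj₂ _)  (inj₁ p₃) = inj₂ (inj₁ (inj₁ (p₁ , p₃)))
two-on-same-side (inj₂ q₁) (inj₁ _)  (inj₂ q₃) = inj₂ (inj₁ (inj₂ (q₁ , q₃)))
two-on-same-side (inj₁ _)  (inj₂ q₂) (inj₂ q₃) = inj₂ (inj₂ (inj₂ (q₂ , q₃)))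
two-on-same-side (inj₂ _)  (inj₁ p₂) (inj₁ p₃) = inj₂ (inj₂ (inj₁ (p₂ , p₃)))

IsInterval-flip : {_<_ : Rel (Fin n) 0ℓ} → IsInterval _<_ X → IsInterval (flip _<_) X
IsInterval-flip interval x y u x∈X y∈X u>x u>y = interval y x u y∈X x∈X u>y u>x

module StrictlyBelow {_<_ : Rel (Fin n) 0ℓ} (sto : IsStrictTotalOrder _≡_ _<_) where

  open IsStrictTotalOrder sto using (compare)

  infix 4 _<ₛ_ _≪_

  _<ₛ_ : Fin n → Subset n → Set
  x <ₛ S = ∀ {s} → s ∈ S → x < s

  _≪_ : Subset n → Subset n → Set
  S ≪ T = ∀ {s} → s ∈ S → s <ₛ T

  below-point⇒below-interval : ∀ {d} → IsInterval _<_ D →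
    x ∉ D → d ∈ D → x < d → x <ₛ D
  below-point⇒below-interval {x = x} {d = d} D-interval x∉D d∈D x<d {e} e∈D
    with compare x e
  ... | tri< x<e _ _ = x<e
  ... | tri≈ _ refl _ = contradiction e∈D x∉D
  ... | tri> _ _ e<x = contradiction (D-interval e d x e∈D d∈D e<x x<d) x∉D

  -- A point of D ∖ X keeps X from reaching past D on the other side.
  overhang-below : ∀ {d} → IsInterval _<_ X → IsInterval _<_ D →
    x ∈ X ─ D → d ∈ D → x < d → Nonempty (D ─ X) → X ─ D ≪ D
  overhang-below {X = X} {D = D} {x = x} X-interval D-interval
                 x∈X─D d∈D x<d (e , e∈D─X) {y} y∈X─D = by-position (compare y e)
    where
    x∈X : x ∈ X
    x∈X = p─q⊆p X D x∈X─D
    x<D : x <ₛ D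
    x<D = below-point⇒below-interval D-interval (x∈p─q⇒x∉q {p = X} x∈X─D) d∈D x<d
    y∈X : y ∈ X
    y∈X = p─q⊆p X D y∈X─D
    y∉D : y ∉ D
    y∉D = x∈p─q⇒x∉q {p = X} y∈X─D
    e∈D : e ∈ D
    e∈D = p─q⊆p D X e∈D─X
    e∉X : e ∉ X
    e∉X = x∈p─q⇒x∉q {p = D} e∈D─X

    by-position : Tri (y < e) (y ≡ e) (e < y) → y <ₛ D
    by-position (tri< y<e _ _) = below-point⇒below-interval D-interval y∉D e∈D y<e
    by-position (tri≈ _ refl _) = contradiction y∈X e∉X
    by-position (tri> _ _ e<y) = contradiction (X-interval x y e x∈X y∈X (x<D e∈D) e<y) e∉X

  nested-overhangs : IsInterval _<_ X → IsInterval _<_ Y →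
    Nonempty (X ∩ D) → Nonempty (Y ∩ D) → X ─ D ≪ D → Y ─ D ≪ D →
    X ⊆ D ∪ Y ⊎ Y ⊆ D ∪ X
  nested-overhangs {X = X} {Y = Y} {D = D}
                   X-interval Y-interval (xd , xd∈X∩D) (yd , yd∈Y∩D) X─D≪D Y─D≪D
    with ⊆-or-∉ X (D ∪ Y)
  ... | inj₁ X⊆D∪Y = inj₁ X⊆D∪Y
  ... | inj₂ (a , a∈X , a∉D∪Y) = inj₂ λ {b} b∈Y →
    decidable-stable (b ∈? D ∪ X) λ b∉D∪X →
      crossing (x∈p∧x∉q⇒x∈p─q a∈X (x∉p∪q⇒x∉p a∉D∪Y)) (x∉p∪q⇒x∉q a∉D∪Y)
               (x∈p∧x∉q⇒x∈p─q b∈Y (x∉p∪q⇒x∉p b∉D∪X)) (x∉p∪q⇒x∉q b∉D∪X)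
    where
    xd∈X : xd ∈ X
    xd∈X = p∩q⊆p X D xd∈X∩D
    xd∈D : xd ∈ D
    xd∈D = p∩q⊆q X D xd∈X∩D
    yd∈Y : yd ∈ Y
    yd∈Y = p∩q⊆p Y D yd∈Y∩D
    yd∈D : yd ∈ D
    yd∈D = p∩q⊆q Y D yd∈Y∩D

    crossing : ∀ {a b} → a ∈ X ─ D → a ∉ Y → b ∈ Y ─ D → b ∉ X → ⊥
    crossing {a} {b} a∈X─D a∉Y b∈Y─D b∉X with compare a b
    ... | tri< a<b _ _ =
      b∉X (X-interval a xd b (p─q⊆p X D a∈X─D) xd∈X a<b (Y─D≪D b∈Y─D xd∈D))
    ... | tri≈ _ refl _ = b∉X (p─q⊆p X D a∈X─D)
    ... | tri> _ _ b<a =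
      a∉Y (Y-interval b yd a (p─q⊆p Y D b∈Y─D) yd∈Y b<a (X─D≪D a∈X─D yd∈D))

module _ {_<_ : Rel (Fin n) 0ℓ} (sto : IsStrictTotalOrder _≡_ _<_) where

  open IsStrictTotalOrder sto using (compare)
  private
    module L = StrictlyBelow sto
    module R = StrictlyBelow (Flip.isStrictTotalOrder sto)

  OverhangsOnOneSide : Subset n → Subset n → Set
  OverhangsOnOneSide X D = X ─ D L.≪ D ⊎ X ─ D R.≪ D

  overlap⇒overhangs-on-one-side : IsInterval _<_ X → IsInterval _<_ D →
    X ≬ D → OverhangsOnOneSide X D
  overlap⇒overhangs-on-one-side {X = X} {D = D} X-interval D-interval
    ((d , d∈X∩D) , (x , x∈X─D) , D─X) = by-position (compare x d)
    where
    d∈D : d ∈ D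
    d∈D = p∩q⊆q X D d∈X∩D

    by-position : Tri (x < d) (x ≡ d) (d < x) → OverhangsOnOneSide X D
    by-position (tri< x<d _ _) =
      inj₁ (L.overhang-below X-interval D-interval x∈X─D d∈D x<d D─X)
    by-position (tri≈ _ refl _) = contradiction d∈D (x∈p─q⇒x∉q {p = X} x∈X─D)
    by-position (tri> _ _ d<x) =
      inj₂ (R.overhang-below (IsInterval-flip X-interval) (IsInterval-flip D-interval)
                             x∈X─D d∈D d<x D─X)

  same-side-overhangs-nested : IsInterval _<_ X → IsInterval _<_ Y → X ≬ D → Y ≬ D →
    (X ─ D L.≪ D × Y ─ D L.≪ D) ⊎ (X ─ D R.≪ D × Y ─ D R.≪ D) →
    X ⊆ D ∪ Y ⊎ Y ⊆ D ∪ X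
  same-side-overhangs-nested X-interval Y-interval (X∩D , _) (Y∩D , _) (inj₁ (X─D≪D , Y─D≪D)) =
    L.nested-overhangs X-interval Y-interval X∩D Y∩D X─D≪D Y─D≪D
  same-side-overhangs-nested X-interval Y-interval (X∩D , _) (Y∩D , _) (inj₂ (X─D≫D , Y─D≫D)) =
    R.nested-overhangs (IsInterval-flip X-interval) (IsInterval-flip Y-interval)
      X∩D Y∩D X─D≫D Y─D≫D

  P2-for-intervals : ∀ {A B C} →
    IsInterval _<_ A → IsInterval _<_ B → IsInterval _<_ C → IsInterval _<_ D →
    A ≬ D → B ≬ D → C ≬ D →
    (A ⊆ D ∪ B ∪ C) ⊎ (B ⊆ D ∪ A ∪ C) ⊎ (C ⊆ D ∪ A ∪ B)
  P2-for-intervals {D = D} A-interval B-interval C-interval D-interval A≬D B≬D C≬D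
    with two-on-same-side (side A-interval A≬D) (side B-interval B≬D) (side C-interval C≬D)
    where
    side : ∀ {X} → IsInterval _<_ X → X ≬ D → OverhangsOnOneSide X D
    side X-interval = overlap⇒overhangs-on-one-side X-interval D-interval
  ... | inj₁ AB = Sum.map ⊆-∪-weakenˡ (inj₁ ∘ ⊆-∪-weakenˡ)
    (same-side-overhangs-nested A-interval B-interval A≬D B≬D AB)
  ... | inj₂ (inj₁ AC) = Sum.map ⊆-∪-weakenʳ (inj₂ ∘ ⊆-∪-weakenˡ)
    (same-side-overhangs-nested A-interval C-interval A≬D C≬D AC)
  ... | inj₂ (inj₂ BC) = inj₂ (Sum.map ⊆-∪-weakenʳ ⊆-∪-weakenʳ
    (same-side-overhangs-nested B-interval C-interval B≬D C≬D BC))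

mainTheorem17 : ∀ (n : ℕ) (𝒞 : SetSystem n) → IsClusteringSystem 𝒞 → IsPyramidal 𝒞 →
    ∀ (A B C D : Subset n) → 𝒞 A → 𝒞 B → 𝒞 C → 𝒞 D →
    A ≬ D → B ≬ D → C ≬ D →
    (A ⊆ D ∪ B ∪ C) ⊎ (B ⊆ D ∪ A ∪ C) ⊎ (C ⊆ D ∪ A ∪ B)
mainTheorem17 n 𝒞 _ (_ , _<_ , sto , interval) A B C D 𝒞A 𝒞B 𝒞C 𝒞D =
  P2-for-intervals sto (interval A 𝒞A) (interval B 𝒞B) (interval C 𝒞C) (interval D 𝒞D)
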